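{- Let $a\in\mathcal A$, $U=\omega\to(a\to a)$, $V=a\to(\omega\to a)$ and $W=(\omega\to a)\to a$. Then: (1) $[U]=\{M\in\mathcal M\mid M\rhd_\beta^*\lambda x.\lambda y.y\}$, and $\lambda x.\lambda y.y:\langle ()\vdash U\rangle$; (2) $[V]=\{M\in\mathcal M\mid M\rhd_\beta^*\lambda x.\lambda y.x\}$, and $\lambda x.\lambda y.x:\langle ()\vdash V\rangle$; (3) $[W]=\{M\in\mathcal M\mid M\rhd_\beta^*\lambda x.xP\text{ for some }P\in\mathcal M\}$, and $\lambda x.xP:\langle env_\omega^{\lambda x.xP}\vdash W\rangle$ for every $P\in\mathcal M$.
   Context: Terms: $\mathcal V$ is a denumerably infinite set of variables; $\mathcal M$ is the set of untyped $\lambda$-terms $M::=x\mid \lambda x.M\mid MM$ taken modulo $\alpha$-conversion; $FV(M)$ is the set of free variables. $\rhd_\beta$ is the compatible closure of $(\lambda x.M)N\rhd_\beta M[x:=N]$ and $\rhd_\beta^*$ its reflexive-transitive closure. Types: $\mathcal A$ is a denumerably infinite set of atomic types; $\mathbb T::=a\mid \mathbb U\to\mathbb T$ ($a\in\mathcal A$) and $\mathbb U::=\omega\mid \mathbb U\sqcap\mathbb U\mid \mathbb T$; types are quotiented by commutativity, associativity and idempotence of $\sqcap$ and by $\omega\sqcap U=U$. $T$ ranges over $\mathbb T$, $U,V$ over $\mathbb U$. Environments: a type environment is a finite set $(x_i:U_i)_n$ of declarations with pairwise distinct variables; $dom$ is its set of variables; $()$ is the empty environment; $\Gamma,x:U$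 requires $x\notin dom(\Gamma)$; $env^M_\omega$ assigns $\omega$ to each variable of $FV(M)$ and nothing else; if $\Gamma_1=(x_i:U_i)_n,(y_j:V_j)_m$ and $\Gamma_2=(x_i:U'_i)_n,(z_k:W_k)_l$ with the $y_j$, $z_k$ all distinct, then $\Gamma_1\sqcap\Gamma_2=(x_i:U_i\sqcap U'_i)_n,(y_j:V_j)_m,(z_k:W_k)_l$. Subtyping: $\sqsubseteq$ (on types, on environments, and on typings $\langle\Gamma\vdash U\rangle$) is the least relation closed under: $\Phi\sqsubseteq\Phi$; transitivity; $U_1\sqcap U_2\sqsubseteq U_1$; if $U_1\sqsubseteq V_1$ and $U_2\sqsubseteq V_2$ then $U_1\sqcap U_2\sqsubseteq V_1\sqcap V_2$; if $U_2\sqsubseteq U_1$ and $T_1\sqsubseteq T_2$ then $U_1\to T_1\sqsubseteq U_2\to T_2$; if $U_1\sqsubseteq U_2$ and $x\notin dom(\Gamma)$ then $\Gamma,x:U_1\sqsubseteq\Gamma,x:U_2$; if $U_1\sqsubseteq U_2$ and $\Gamma_2\sqsubseteq\Gamma_1$ then $\langle\Gamma_1\vdash U_1\rangle\sqsubseteq\langle\Gamma_2\vdash U_2\rangle$. Typing rules for $M:\langle\Gamma\vdash U\rangle$: (ax) $x:\langle x:T\vdash T\rangle$ for $T\in\mathbb T$; ($\omega$) $M:\langle env^M_\omega\vdash\omega\rangle$; ($\to_i$) from $M:\langle\Gamma,x:U\vdash T\rangle$ infer $\lambda x.M:\langle\Gamma\vdash U\to T\rangle$; ($\to'_i$) from $M:\langle\Gamma\vdash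 T\rangle$ and $x\notin dom(\Gamma)$ infer $\lambda x.M:\langle\Gamma\vdash\omega\to T\rangle$; ($\to_e$) from $M_1:\langle\Gamma_1\vdash U\to T\rangle$ and $M_2:\langle\Gamma_2\vdash U\rangle$ infer $M_1M_2:\langle\Gamma_1\sqcap\Gamma_2\vdash T\rangle$; ($\sqcap_i$) from $M:\langle\Gamma\vdash U_1\rangle$ and $M:\langle\Gamma\vdash U_2\rangle$ infer $M:\langle\Gamma\vdash U_1\sqcap U_2\rangle$; ($\sqsubseteq$) from $M:\langle\Gamma\vdash U\rangle$ and $\langle\Gamma\vdash U\rangle\sqsubseteq\langle\Gamma'\vdash U'\rangle$ infer $M:\langle\Gamma'\vdash U'\rangle$. Semantics: for $\mathcal X,\mathcal Y\subseteq\mathcal M$, $\mathcal X\leadsto\mathcal Y=\{M\in\mathcal M\mid MN\in\mathcal Y\text{ for all }N\in\mathcal X\}$. $\mathcal X$ is $\beta$-saturated if $M\rhd_\beta^*N$ and $N\in\mathcal X$ imply $M\in\mathcal X$. A $\beta$-interpretation is a function $\mathcal I:\mathcal A\to\mathcal P(\mathcal M)$ with every $\mathcal I(a)$ $\beta$-saturated, extended to $\mathbb U$ by $\mathcal I(\omega)=\mathcal M$, $\mathcal I(U_1\sqcap U_2)=\mathcal I(U_1)\cap\mathcal I(U_2)$, $\mathcal I(U\to T)=\mathcal I(U)\leadsto\mathcal I(T)$. The meaning of $U$ is $[U]=\bigcap\{\mathcal I(U)\mid \mathcal I\text{ a }\beta\text{ -interpretation}\}$. -}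

module Defs where

open import Data.Nat using (ℕ; zero; suc; _≡ᵇ_)
open import Data.Bool using (Bool; true; false; _∨_; if_then_else_)
open import Data.Maybe using (Maybe; just; nothing)
open import Data.Unit using (⊤)
open import Data.Product using (_×_)
open import Relation.Binary.PropositionalEquality using (_≡_)
open import Relation.Binary.Construct.Closure.ReflexiveTransitive using (Star)

-- λ-terms modulo α-conversion: de Bruijn representation.
-- Variables (free and bound) are natural numbers; `var 0` under a `ƛ`
-- refers to the innermost binder.

infixl 7 _·_
infix  6 ƛ_

data Term : Set where
  var : ℕ → Term
  ƛ_  : Term → Term
  _·_ : Term → Term → Term

ext : (ℕ → ℕ) → ℕ → ℕ
ext ρ zero    = zero
ext ρ (suc n) = suc (ρ n)

rename : (ℕ → ℕ) → Term → Term
rename ρ (var x) = var (ρ x)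
rename ρ (ƛ M)   = ƛ rename (ext ρ) M
rename ρ (M · N) = rename ρ M · rename ρ N

exts : (ℕ → Term) → ℕ → Term
exts σ zero    = var zero
exts σ (suc n) = rename suc (σ n)

subst : (ℕ → Term) → Term → Term
subst σ (var x) = σ x
subst σ (ƛ M)   = ƛ subst (exts σ) M
subst σ (M · N) = subst σ M · subst σ N

single-σ : Term → ℕ → Term
single-σ N zero    = N
single-σ N (suc n) = var n

_[_] : Term → Term → Term
M [ N ] = subst (single-σ N) M

infix 4 _⟶β_ _⟶β*_
data _⟶β_ : Term → Term → Set where
  β    : ∀ {M N} → (ƛ M) · N ⟶β M [ N ]
  ξ-ƛ  : ∀ {M M'} → M ⟶β M' → ƛ M ⟶β ƛ M'
  ξ-·₁ : ∀ {M M' N} → M ⟶β M' → M · N ⟶β M' · N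
  ξ-·₂ : ∀ {M N N'} → N ⟶β N' → M · N ⟶β M · N'

_⟶β*_ : Term → Term → Set
_⟶β*_ = Star _⟶β_

free : Term → ℕ → Bool
free (var y) x = x ≡ᵇ y
free (ƛ M)   x = free M (suc x)
free (M · N) x = free M x ∨ free N x

-- Atomic types are indexed by ℕ (a denumerable set).
-- 𝕋 ::= a | 𝕌 → 𝕋,   𝕌 ::= ω | 𝕌 ⊓ 𝕌 | 𝕋
-- The quotient by ACI of ⊓ and ω ⊓ U = U is handled by building the
-- generating equations into the subtyping relation (both directions),
-- so that every judgement below is invariant under the quotient.

infixr 8 _⇒_
infixl 9 _⊓_

mutual
  data TyT : Set where
    atom : ℕ → TyT
    _⇒_  : TyU → TyT → TyT

  data TyU : Set where
    ω   : TyU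
    _⊓_ : TyU → TyU → TyU
    ⌜_⌝ : TyT → TyU

infix 4 _⊑_
data _⊑_ : TyU → TyU → Set where
  ⊑-refl  : ∀ {U} → U ⊑ U
  ⊑-trans : ∀ {U V W} → U ⊑ V → V ⊑ W → U ⊑ W
  ⊑-proj  : ∀ {U₁ U₂} → U₁ ⊓ U₂ ⊑ U₁
  ⊑-⊓     : ∀ {U₁ U₂ V₁ V₂} → U₁ ⊑ V₁ → U₂ ⊑ V₂ → U₁ ⊓ U₂ ⊑ V₁ ⊓ V₂
  ⊑-⇒     : ∀ {U₁ U₂ T₁ T₂} → U₂ ⊑ U₁ → ⌜ T₁ ⌝ ⊑ ⌜ T₂ ⌝
            → ⌜ U₁ ⇒ T₁ ⌝ ⊑ ⌜ U₂ ⇒ T₂ ⌝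
  -- generating equations of the quotient (the converse directions
  -- of idempotence and unit follow from ⊑-proj and ⊑-comm)
  ⊑-comm   : ∀ {U V} → U ⊓ V ⊑ V ⊓ U
  ⊑-assocˡ : ∀ {U V W} → (U ⊓ V) ⊓ W ⊑ U ⊓ (V ⊓ W)
  ⊑-assocʳ : ∀ {U V W} → U ⊓ (V ⊓ W) ⊑ (U ⊓ V) ⊓ W
  ⊑-idem   : ∀ {U} → U ⊑ U ⊓ U
  ⊑-unit   : ∀ {U} → U ⊑ ω ⊓ U

-- Type environments: finite partial maps from variables to types,
-- represented as functions (every environment arising below has
-- finite domain).

Env : Set
Env = ℕ → Maybe TyU

∅ : Env
∅ _ = nothing

single : ℕ → TyU → Env
single zero    U zero    = just U
single zero    U (suc y) = nothing
single (suc x) U zero    = nothing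
single (suc x) U (suc y) = single x U y

envω : Term → Env
envω M x = if free M x then just ω else nothing

_⊓ₘ_ : Maybe TyU → Maybe TyU → Maybe TyU
just U  ⊓ₘ just V  = just (U ⊓ V)
just U  ⊓ₘ nothing = just U
nothing ⊓ₘ m       = m

_⊓ₑ_ : Env → Env → Env
(Γ₁ ⊓ₑ Γ₂) x = Γ₁ x ⊓ₘ Γ₂ x

data _⊑ₘ_ : Maybe TyU → Maybe TyU → Set where
  nothing⊑ : nothing ⊑ₘ nothing
  just⊑    : ∀ {U V} → U ⊑ V → just U ⊑ₘ just V

_⊑ₑ_ : Env → Env → Set
Γ ⊑ₑ Γ' = ∀ x → Γ x ⊑ₘ Γ' x

-- Typing  M : ⟨ Γ ⊢ U ⟩.
-- In de Bruijn style, the body of ƛ M is typed in an environment Δ whose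
-- entry at 0 is the bound variable x, and Γ = Δ ∘ suc.

infix 3 _⦂⟨_⊢_⟩
data _⦂⟨_⊢_⟩ : Term → Env → TyU → Set where
  ax   : ∀ {x T} → var x ⦂⟨ single x ⌜ T ⌝ ⊢ ⌜ T ⌝ ⟩
  ω-i  : ∀ {M} → M ⦂⟨ envω M ⊢ ω ⟩
  ⇒-i  : ∀ {M Δ U T} → M ⦂⟨ Δ ⊢ ⌜ T ⌝ ⟩ → Δ zero ≡ just U
         → ƛ M ⦂⟨ (λ n → Δ (suc n)) ⊢ ⌜ U ⇒ T ⌝ ⟩
  ⇒-i' : ∀ {M Δ T} → M ⦂⟨ Δ ⊢ ⌜ T ⌝ ⟩ → Δ zero ≡ nothing
         → ƛ M ⦂⟨ (λ n → Δ (suc n)) ⊢ ⌜ ω ⇒ T ⌝ ⟩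
  ⇒-e  : ∀ {M₁ M₂ Γ₁ Γ₂ U T} → M₁ ⦂⟨ Γ₁ ⊢ ⌜ U ⇒ T ⌝ ⟩ → M₂ ⦂⟨ Γ₂ ⊢ U ⟩
         → M₁ · M₂ ⦂⟨ Γ₁ ⊓ₑ Γ₂ ⊢ ⌜ T ⌝ ⟩
  ⊓-i  : ∀ {M Γ U₁ U₂} → M ⦂⟨ Γ ⊢ U₁ ⟩ → M ⦂⟨ Γ ⊢ U₂ ⟩ → M ⦂⟨ Γ ⊢ U₁ ⊓ U₂ ⟩
  sub  : ∀ {M Γ Γ' U U'} → M ⦂⟨ Γ ⊢ U ⟩ → Γ' ⊑ₑ Γ → U ⊑ U'
         → M ⦂⟨ Γ' ⊢ U' ⟩

Pred : Set₁
Pred = Term → Set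

_↝_ : Pred → Pred → Pred
(X ↝ Y) M = ∀ N → X N → Y (M · N)

βSaturated : Pred → Set
βSaturated X = ∀ {M N} → M ⟶β* N → X N → X M

-- an interpretation of the atoms (β-saturation is required separately)
Interp : Set₁
Interp = ℕ → Pred

mutual
  ⟦_⟧T : TyT → Interp → Pred
  ⟦ atom a ⟧T I = I a
  ⟦ U ⇒ T ⟧T  I = ⟦ U ⟧U I ↝ ⟦ T ⟧T I

  ⟦_⟧U : TyU → Interp → Pred
  ⟦ ω ⟧U       I _ = ⊤
  ⟦ U ⊓ V ⟧U   I M = ⟦ U ⟧U I M × ⟦ V ⟧U I M
  ⟦ ⌜ T ⌝ ⟧U   I = ⟦ T ⟧T I

[_] : TyU → Term → Set₁
[ U ] M = (I : Interp) → (∀ a → βSaturated (I a)) → ⟦ U ⟧U I M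

-- Inclusion ⊇ ("soundness"): every meaning [U] is closed under β-expansion,
-- and the canonical term lies in it by one or two head β-steps.
-- Inclusion ⊆ ("completeness"): take n with every free variable of M below n
-- (so var n and var (suc n) are fresh for M), and interpret every atom as the
-- set of terms reducing to the expected normal form, e.g. to var (suc n) for U.
-- The hypothesis M ∈ [U] then yields a reduction  M · var n · var (suc n) ↠
-- var (suc n).  A reduction of an application to a variable must fire a head
-- redex; a contractum B [ var x ] is a renaming of B, and reductions out of a
-- renamed term are renamings of reductions of the original term.  Tracking the
-- fresh variables through these facts forces M ↠ λxy.y (resp. λxy.x, λx.xP).
module Submission where

open import Defs
open import Data.Nat using (ℕ)
open import Data.Product using (_×_; ∃)
open import Function.Bundles using (_⇔_)

open import Data.Nat using (zero; suc; _<_; _≤_; s≤s; z≤n; _⊔_)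
open import Data.Nat.Properties
  using (≤-trans; ≤-refl; n≤1+n; n<1+n; m≤m⊔n; m≤n⊔m; <-irrefl; 1+n≢n)
open import Data.Product using (_,_)
open import Data.Sum using (_⊎_; inj₁; inj₂)
open import Data.Empty using (⊥-elim)
open import Data.Unit using (tt)
open import Data.Maybe using (just; nothing)
open import Data.Bool using (true; false)
open import Function using (_∘_)
open import Function.Bundles using (mk⇔)
open import Relation.Binary.PropositionalEquality
  using (_≡_; refl; sym; trans; cong; cong₂; module ≡-Reasoning)
  renaming (subst to ≡-subst)
open import Relation.Binary.Construct.Closure.ReflexiveTransitive
  using (ε; _◅_; _◅◅_; gmap)

ext-cong : ∀ {ρ ρ' : ℕ → ℕ} → (∀ x → ρ x ≡ ρ' x) → ∀ x → ext ρ x ≡ ext ρ' x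
ext-cong h zero    = refl
ext-cong h (suc x) = cong suc (h x)

rename-cong : ∀ {ρ ρ'} → (∀ x → ρ x ≡ ρ' x) → ∀ M → rename ρ M ≡ rename ρ' M
rename-cong h (var x) = cong var (h x)
rename-cong h (ƛ M)   = cong ƛ_ (rename-cong (ext-cong h) M)
rename-cong h (M · N) = cong₂ _·_ (rename-cong h M) (rename-cong h N)

exts-cong : ∀ {σ σ' : ℕ → Term} → (∀ x → σ x ≡ σ' x) → ∀ x → exts σ x ≡ exts σ' x
exts-cong h zero    = refl
exts-cong h (suc x) = cong (rename suc) (h x)

subst-cong : ∀ {σ σ'} → (∀ x → σ x ≡ σ' x) → ∀ M → subst σ M ≡ subst σ' M
subst-cong h (var x) = h x
subst-cong h (ƛ M)   = cong ƛ_ (subst-cong (exts-cong h) M)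
subst-cong h (M · N) = cong₂ _·_ (subst-cong h M) (subst-cong h N)

rename-rename : ∀ ρ ρ' M → rename ρ (rename ρ' M) ≡ rename (ρ ∘ ρ') M
rename-rename ρ ρ' (var x) = refl
rename-rename ρ ρ' (ƛ M)   = cong ƛ_ (trans (rename-rename (ext ρ) (ext ρ') M)
  (rename-cong (λ { zero → refl ; (suc x) → refl }) M))
rename-rename ρ ρ' (M · N) = cong₂ _·_ (rename-rename ρ ρ' M) (rename-rename ρ ρ' N)

subst-rename : ∀ σ ρ M → subst σ (rename ρ M) ≡ subst (σ ∘ ρ) M
subst-rename σ ρ (var x) = refl
subst-rename σ ρ (ƛ M)   = cong ƛ_ (trans (subst-rename (exts σ) (ext ρ) M)
  (subst-cong (λ { zero → refl ; (suc x) → refl }) M))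
subst-rename σ ρ (M · N) = cong₂ _·_ (subst-rename σ ρ M) (subst-rename σ ρ N)

rename-subst : ∀ ρ σ M → rename ρ (subst σ M) ≡ subst (rename ρ ∘ σ) M
rename-subst ρ σ (var x) = refl
rename-subst ρ σ (ƛ M)   = cong ƛ_ (trans (rename-subst (ext ρ) (exts σ) M)
  (subst-cong (λ { zero → refl
                 ; (suc x) → trans (rename-rename (ext ρ) suc (σ x))
                                   (sym (rename-rename suc ρ (σ x))) }) M))
rename-subst ρ σ (M · N) = cong₂ _·_ (rename-subst ρ σ M) (rename-subst ρ σ N)

subst-var : ∀ ρ M → subst (var ∘ ρ) M ≡ rename ρ M
subst-var ρ (var x) = refl
subst-var ρ (ƛ M)   = cong ƛ_ (trans (subst-cong (λ { zero → refl ; (suc x) → refl }) M)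
  (subst-var (ext ρ) M))
subst-var ρ (M · N) = cong₂ _·_ (subst-var ρ M) (subst-var ρ N)

subst-id : ∀ M → subst var M ≡ M
subst-id (var x) = refl
subst-id (ƛ M)   = cong ƛ_ (trans (subst-cong (λ { zero → refl ; (suc x) → refl }) M)
  (subst-id M))
subst-id (M · N) = cong₂ _·_ (subst-id M) (subst-id N)

rename-[] : ∀ ρ M N → rename ρ (_[_] M N) ≡ _[_] (rename (ext ρ) M) (rename ρ N)
rename-[] ρ M N = begin
  rename ρ (subst (single-σ N) M)                ≡⟨ rename-subst ρ (single-σ N) M ⟩
  subst (rename ρ ∘ single-σ N) M                ≡⟨ subst-cong (λ { zero → refl ; (suc x) → refl }) M ⟩
  subst (single-σ (rename ρ N) ∘ ext ρ) M        ≡⟨ sym (subst-rename (single-σ (rename ρ N)) (ext ρ) M) ⟩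
  subst (single-σ (rename ρ N)) (rename (ext ρ) M) ∎
  where open ≡-Reasoning

weaken-[] : ∀ M N → _[_] (rename suc M) N ≡ M
weaken-[] M N = trans (subst-rename (single-σ N) suc M) (subst-id M)

opening : ℕ → ℕ → ℕ
opening x zero    = x
opening x (suc y) = y

[var] : ∀ M x → _[_] M (var x) ≡ rename (opening x) M
[var] M x = trans (subst-cong (λ { zero → refl ; (suc y) → refl }) M) (subst-var (opening x) M)

ƛ-⟶β* : ∀ {M M'} → M ⟶β* M' → ƛ M ⟶β* ƛ M'
ƛ-⟶β* = gmap ƛ_ ξ-ƛ

·ˡ-⟶β* : ∀ {M M' N} → M ⟶β* M' → M · N ⟶β* M' · N
·ˡ-⟶β* {N = N} = gmap (_· N) ξ-·₁

-- Renaming creates no redexes: a step out of a renamed term is the renaming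
-- of a step out of the original term.
rename-reflects-⟶β : ∀ ρ B {C} → rename ρ B ⟶β C → ∃ λ B' → (B ⟶β B') × (rename ρ B' ≡ C)
rename-reflects-⟶β ρ (ƛ B) (ξ-ƛ s) with rename-reflects-⟶β (ext ρ) B s
... | B' , s' , refl = ƛ B' , ξ-ƛ s' , refl
rename-reflects-⟶β ρ ((ƛ B₁) · B₂) β = _[_] B₁ B₂ , β , rename-[] ρ B₁ B₂
rename-reflects-⟶β ρ (B₁ · B₂) (ξ-·₁ s) with rename-reflects-⟶β ρ B₁ s
... | B' , s' , refl = B' · B₂ , ξ-·₁ s' , refl
rename-reflects-⟶β ρ (B₁ · B₂) (ξ-·₂ s) with rename-reflects-⟶β ρ B₂ s
... | B' , s' , refl = B₁ · B' , ξ-·₂ s' , refl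

rename-reflects-⟶β* : ∀ ρ B {C} → rename ρ B ⟶β* C → ∃ λ B' → (B ⟶β* B') × (rename ρ B' ≡ C)
rename-reflects-⟶β* ρ B ε = B , ε , refl
rename-reflects-⟶β* ρ B (s ◅ r) with rename-reflects-⟶β ρ B s
... | B₁ , s' , refl with rename-reflects-⟶β* ρ B₁ r
...   | B' , r' , e = B' , s' ◅ r' , e

rename-reflects-var : ∀ ρ B {r} → rename ρ B ⟶β* var r → ∃ λ j → (B ⟶β* var j) × (ρ j ≡ r)
rename-reflects-var ρ B red with rename-reflects-⟶β* ρ B red
... | var j , B↠ , refl = j , B↠ , refl

rename-reflects-ƛ : ∀ ρ B {A} → rename ρ B ⟶β* ƛ A
                  → ∃ λ B' → (B ⟶β* ƛ B') × (rename (ext ρ) B' ≡ A)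
rename-reflects-ƛ ρ B red with rename-reflects-⟶β* ρ B red
... | ƛ B' , B↠ , refl = B' , B↠ , refl

rename-reflects-var· : ∀ ρ B {r Q} → rename ρ B ⟶β* var r · Q
                     → ∃ λ j → ∃ λ P → (B ⟶β* var j · P) × (ρ j ≡ r)
rename-reflects-var· ρ B red with rename-reflects-⟶β* ρ B red
... | var j · P , B↠ , refl = j , P , B↠ , refl

-- A variable argument never reduces, so a reduction of M · var x either fires
-- a head redex (after reducing M to an abstraction) or merely reduces M.
app-var-inv : ∀ {M x P} → M · var x ⟶β* P
            → (∃ λ B → (M ⟶β* ƛ B) × (rename (opening x) B ⟶β* P))
              ⊎ (∃ λ M' → (M ⟶β* M') × (P ≡ M' · var x))
app-var-inv {M} ε = inj₂ (M , ε , refl)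
app-var-inv {x = x} (β {M = B} ◅ r) = inj₁ (B , ε , ≡-subst (_⟶β* _) ([var] B x) r)
app-var-inv (ξ-·₁ s ◅ r) with app-var-inv r
... | inj₁ (B , M↠ , B↠) = inj₁ (B , s ◅ M↠ , B↠)
... | inj₂ (M' , M↠ , e) = inj₂ (M' , s ◅ M↠ , e)
app-var-inv (ξ-·₂ () ◅ r)

-- Scoping: Scoped n M means that every free variable of M is below n,
-- so that var n, var (suc n), … are fresh for M.

Scoped : ℕ → Term → Set
Scoped n (var x) = x < n
Scoped n (ƛ M)   = Scoped (suc n) M
Scoped n (M · N) = Scoped n M × Scoped n N

scoped-weaken : ∀ {n m} M → n ≤ m → Scoped n M → Scoped m M
scoped-weaken (var x) le h       = ≤-trans h le
scoped-weaken (ƛ M)   le h       = scoped-weaken M (s≤s le) h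
scoped-weaken (M · N) le (a , b) = scoped-weaken M le a , scoped-weaken N le b

has-scope : ∀ M → ∃ λ n → Scoped n M
has-scope (var x) = suc x , n<1+n x
has-scope (ƛ M) with has-scope M
... | n , s = n , scoped-weaken M (n≤1+n n) s
has-scope (M · N) with has-scope M | has-scope N
... | m , sM | n , sN = m ⊔ n , scoped-weaken M (m≤m⊔n m n) sM , scoped-weaken N (m≤n⊔m m n) sN

scoped-rename : ∀ {n m ρ} M → (∀ {x} → x < n → ρ x < m) → Scoped n M → Scoped m (rename ρ M)
scoped-rename (var x) f h = f h
scoped-rename {ρ = ρ} (ƛ M) f h = scoped-rename M f' h
  where
  f' : ∀ {x} → x < suc _ → ext ρ x < suc _
  f' {zero}  _       = s≤s z≤n
  f' {suc x} (s≤s l) = s≤s (f l)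
scoped-rename (M · N) f (a , b) = scoped-rename M f a , scoped-rename N f b

scoped-subst : ∀ {n m σ} M → (∀ {x} → x < n → Scoped m (σ x)) → Scoped n M → Scoped m (subst σ M)
scoped-subst (var x) f h = f h
scoped-subst {σ = σ} (ƛ M) f h = scoped-subst M f' h
  where
  f' : ∀ {x} → x < suc _ → Scoped (suc _) (exts σ x)
  f' {zero}  _       = s≤s z≤n
  f' {suc x} (s≤s l) = scoped-rename (σ x) s≤s (f l)
scoped-subst (M · N) f (a , b) = scoped-subst M f a , scoped-subst N f b

scoped-⟶β : ∀ {n M M'} → M ⟶β M' → Scoped n M → Scoped n M'
scoped-⟶β {n} (β {M} {N}) (sM , sN) = scoped-subst M σ-scoped sM
  where
  σ-scoped : ∀ {x} → x < suc n → Scoped n (single-σ N x)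
  σ-scoped {zero}  _       = sN
  σ-scoped {suc x} (s≤s l) = l
scoped-⟶β (ξ-ƛ s)  h       = scoped-⟶β s h
scoped-⟶β (ξ-·₁ s) (a , b) = scoped-⟶β s a , b
scoped-⟶β (ξ-·₂ s) (a , b) = a , scoped-⟶β s b

scoped-⟶β* : ∀ {n M M'} → M ⟶β* M' → Scoped n M → Scoped n M'
scoped-⟶β* ε       h = h
scoped-⟶β* (s ◅ r) h = scoped-⟶β* r (scoped-⟶β s h)

fresh-pair-probe : ∀ {n r M} → Scoped n M → n ≤ r → M · var n · var (suc n) ⟶β* var r
                 → (M ⟶β* ƛ ƛ var 0 × r ≡ suc n) ⊎ (M ⟶β* ƛ ƛ var 1 × r ≡ n)
fresh-pair-probe {n} {r} {M} sM n≤r red with app-var-inv red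
... | inj₂ (_ , _ , ())
... | inj₁ (A , Mn↠ƛA , A↠r) with app-var-inv Mn↠ƛA
...   | inj₂ (_ , _ , ())
...   | inj₁ (B , M↠ƛB , B↠ƛA) with rename-reflects-ƛ (opening n) B B↠ƛA
...     | B₂ , B↠ƛB₂ , refl with rename-reflects-var (opening (suc n)) _ A↠r
...       | i , A↠i , refl with rename-reflects-var (ext (opening n)) B₂ A↠i
...         | j , B₂↠j , refl = project j M↠ƛƛj (scoped-⟶β* M↠ƛƛj sM) n≤r
  where
  M↠ƛƛj : M ⟶β* ƛ ƛ var j
  M↠ƛƛj = M↠ƛB ◅◅ ƛ-⟶β* (B↠ƛB₂ ◅◅ ƛ-⟶β* B₂↠j)
  -- the composite renaming sends 0 ↦ suc n, 1 ↦ n and k+2 ↦ k < n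
  project : ∀ j → M ⟶β* ƛ ƛ var j → j < suc (suc n)
          → n ≤ opening (suc n) (ext (opening n) j)
          → (M ⟶β* ƛ ƛ var 0 × opening (suc n) (ext (opening n) j) ≡ suc n)
            ⊎ (M ⟶β* ƛ ƛ var 1 × opening (suc n) (ext (opening n) j) ≡ n)
  project zero          M↠ _                 _   = inj₁ (M↠ , refl)
  project (suc zero)    M↠ _                 _   = inj₂ (M↠ , refl)
  project (suc (suc k)) _  (s≤s (s≤s k<n)) n≤k = ⊥-elim (<-irrefl refl (≤-trans k<n n≤k))

fresh-head-probe : ∀ {n M Q} → Scoped n M → M · var n ⟶β* var n · Q
                 → ∃ λ P → M ⟶β* ƛ (var 0 · P)
fresh-head-probe {n} sM red with app-var-inv red
... | inj₂ (M' , M↠M' , refl) = ⊥-elim (<-irrefl refl (scoped-⟶β* M↠M' sM))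
... | inj₁ (B , M↠ƛB , B↠nQ) with rename-reflects-var· (opening n) B B↠nQ
...   | j , P , B↠jP , eq = P , M↠ƛB ◅◅ ƛ-⟶β* (headIsBound j eq B↠jP)
  where
  -- among the variables in scope of λ-body, only the bound one is opened to n
  headIsBound : ∀ j → opening n j ≡ n → B ⟶β* var j · P → B ⟶β* var 0 · P
  headIsBound zero    _  B↠ = B↠
  headIsBound (suc k) refl B↠ with scoped-⟶β* (M↠ƛB ◅◅ ƛ-⟶β* B↠) sM
  ... | s≤s k<k , _ = ⊥-elim (<-irrefl refl k<k)

mutual
  ⟦⟧T-saturated : ∀ T I → (∀ a → βSaturated (I a)) → βSaturated (⟦ T ⟧T I)
  ⟦⟧T-saturated (atom a) I sat = sat a
  ⟦⟧T-saturated (U ⇒ T)  I sat r h N hN = ⟦⟧T-saturated T I sat (·ˡ-⟶β* r) (h N hN)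

  ⟦⟧U-saturated : ∀ U I → (∀ a → βSaturated (I a)) → βSaturated (⟦ U ⟧U I)
  ⟦⟧U-saturated ω       I sat r _       = tt
  ⟦⟧U-saturated (U ⊓ V) I sat r (h , k) =
    ⟦⟧U-saturated U I sat r h , ⟦⟧U-saturated V I sat r k
  ⟦⟧U-saturated ⌜ T ⌝   I sat r h       = ⟦⟧T-saturated T I sat r h

[]-expand : ∀ U {M N} → M ⟶β* N → [ U ] N → [ U ] M
[]-expand U r h I sat = ⟦⟧U-saturated U I sat r (h I sat)

-- The terms reducing into a set S form a β-saturated set; interpreting all
-- atoms by such a set is how the completeness proofs extract reductions.
Reducts : Pred → Pred
Reducts S X = ∃ λ Y → (X ⟶β* Y) × S Y

Reducts-saturated : ∀ S → βSaturated (Reducts S)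
Reducts-saturated S r (Y , r' , s) = Y , r ◅◅ r' , s

λxy·y∈[U] : ∀ a → [ ⌜ ω ⇒ ⌜ atom a ⌝ ⇒ atom a ⌝ ] (ƛ ƛ var 0)
λxy·y∈[U] a I sat N _ N' h = sat a (ξ-·₁ β ◅ β ◅ ε) h

λxy·x∈[V] : ∀ a → [ ⌜ ⌜ atom a ⌝ ⇒ ω ⇒ atom a ⌝ ] (ƛ ƛ var 1)
λxy·x∈[V] a I sat N h N' _ = sat a (ξ-·₁ β ◅ β ◅ ε) (≡-subst (I a) (sym (weaken-[] N N')) h)

λx·xP∈[W] : ∀ a P → [ ⌜ ⌜ ω ⇒ atom a ⌝ ⇒ atom a ⌝ ] (ƛ (var 0 · P))
λx·xP∈[W] a P I sat N h = sat a (β ◅ ε) (h (_[_] P N) tt)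

meaning-U : ∀ a M → [ ⌜ ω ⇒ ⌜ atom a ⌝ ⇒ atom a ⌝ ] M ⇔ (M ⟶β* ƛ ƛ var 0)
meaning-U a M = mk⇔ complete (λ r → []-expand ⌜ ω ⇒ ⌜ atom a ⌝ ⇒ atom a ⌝ r (λxy·y∈[U] a))
  where
  complete : [ ⌜ ω ⇒ ⌜ atom a ⌝ ⇒ atom a ⌝ ] M → M ⟶β* ƛ ƛ var 0
  complete h with has-scope M
  ... | n , sM with h (λ _ → Reducts (_≡ var (suc n))) (λ _ → Reducts-saturated _)
                      (var n) tt (var (suc n)) (var (suc n) , ε , refl)
  ... | _ , red , refl with fresh-pair-probe sM (n≤1+n n) red
  ...   | inj₁ (M↠ , _) = M↠
  ...   | inj₂ (_ , e)  = ⊥-elim (1+n≢n e)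

meaning-V : ∀ a M → [ ⌜ ⌜ atom a ⌝ ⇒ ω ⇒ atom a ⌝ ] M ⇔ (M ⟶β* ƛ ƛ var 1)
meaning-V a M = mk⇔ complete (λ r → []-expand ⌜ ⌜ atom a ⌝ ⇒ ω ⇒ atom a ⌝ r (λxy·x∈[V] a))
  where
  complete : [ ⌜ ⌜ atom a ⌝ ⇒ ω ⇒ atom a ⌝ ] M → M ⟶β* ƛ ƛ var 1
  complete h with has-scope M
  ... | n , sM with h (λ _ → Reducts (_≡ var n)) (λ _ → Reducts-saturated _)
                      (var n) (var n , ε , refl) (var (suc n)) tt
  ... | _ , red , refl with fresh-pair-probe sM ≤-refl red
  ...   | inj₁ (_ , e)  = ⊥-elim (1+n≢n (sym e))
  ...   | inj₂ (M↠ , _) = M↠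

meaning-W : ∀ a M → [ ⌜ ⌜ ω ⇒ atom a ⌝ ⇒ atom a ⌝ ] M ⇔ ∃ (λ P → M ⟶β* ƛ (var 0 · P))
meaning-W a M = mk⇔ complete (λ { (P , r) → []-expand ⌜ ⌜ ω ⇒ atom a ⌝ ⇒ atom a ⌝ r (λx·xP∈[W] a P) })
  where
  complete : [ ⌜ ⌜ ω ⇒ atom a ⌝ ⇒ atom a ⌝ ] M → ∃ (λ P → M ⟶β* ƛ (var 0 · P))
  complete h with has-scope M
  ... | n , sM with h (λ _ → Reducts (λ Y → ∃ λ Q → Y ≡ var n · Q))
                      (λ _ → Reducts-saturated _)
                      (var n) (λ Q _ → var n · Q , ε , Q , refl)
  ... | _ , red , _ , refl = fresh-head-probe sM red

λxy·y⦂U : ∀ a → (ƛ ƛ var 0) ⦂⟨ ∅ ⊢ ⌜ ω ⇒ ⌜ atom a ⌝ ⇒ atom a ⌝ ⟩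
λxy·y⦂U a = ⇒-i' {Δ = λ n → single 0 ⌜ atom a ⌝ (suc n)} (⇒-i ax refl) refl

λxy·x⦂V : ∀ a → (ƛ ƛ var 1) ⦂⟨ ∅ ⊢ ⌜ ⌜ atom a ⌝ ⇒ ω ⇒ atom a ⌝ ⟩
λxy·x⦂V a = ⇒-i {Δ = λ n → single 1 ⌜ atom a ⌝ (suc n)} (⇒-i' {Δ = single 1 ⌜ atom a ⌝} ax refl) refl

_▷_ : Env → TyU → Env
(Γ ▷ U) zero    = just U
(Γ ▷ U) (suc n) = Γ n

⊑ₘ-refl : ∀ m → m ⊑ₘ m
⊑ₘ-refl (just U) = just⊑ ⊑-refl
⊑ₘ-refl nothing  = nothing⊑

-- Declaring x : U refines the environment (x : U) ⊓ env^P_ω, where x may or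
-- may not be free in P (and then carries the extra, harmless, ω).
▷-⊑-⊓envω : ∀ U P → ((envω P ∘ suc) ▷ U) ⊑ₑ (single 0 U ⊓ₑ envω P)
▷-⊑-⊓envω U P zero with free P zero
... | true  = just⊑ (⊑-trans ⊑-unit ⊑-comm)
... | false = just⊑ ⊑-refl
▷-⊑-⊓envω U P (suc n) = ⊑ₘ-refl (envω P (suc n))

λx·xP⦂W : ∀ a P → (ƛ (var 0 · P)) ⦂⟨ envω (ƛ (var 0 · P)) ⊢ ⌜ ⌜ ω ⇒ atom a ⌝ ⇒ atom a ⌝ ⟩
λx·xP⦂W a P = ⇒-i (sub (⇒-e ax ω-i) (▷-⊑-⊓envω _ P) ⊑-refl) refl

lemma5p5 : (a : ℕ) →
  -- (1) U = ω → (a → a);  λx.λy.y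
  ((∀ M → [ ⌜ ω ⇒ ⌜ atom a ⌝ ⇒ atom a ⌝ ] M ⇔ (M ⟶β* ƛ ƛ var 0))
    × (ƛ ƛ var 0) ⦂⟨ ∅ ⊢ ⌜ ω ⇒ ⌜ atom a ⌝ ⇒ atom a ⌝ ⟩)
  -- (2) V = a → (ω → a);  λx.λy.x
  × ((∀ M → [ ⌜ ⌜ atom a ⌝ ⇒ ω ⇒ atom a ⌝ ] M ⇔ (M ⟶β* ƛ ƛ var 1))
    × (ƛ ƛ var 1) ⦂⟨ ∅ ⊢ ⌜ ⌜ atom a ⌝ ⇒ ω ⇒ atom a ⌝ ⟩)
  -- (3) W = (ω → a) → a;  λx.xP  (P may mention x = var 0)
  × ((∀ M → [ ⌜ ⌜ ω ⇒ atom a ⌝ ⇒ atom a ⌝ ] M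
              ⇔ ∃ (λ P → M ⟶β* ƛ (var 0 · P)))
    × (∀ P → (ƛ (var 0 · P))
               ⦂⟨ envω (ƛ (var 0 · P)) ⊢ ⌜ ⌜ ω ⇒ atom a ⌝ ⇒ atom a ⌝ ⟩))
lemma5p5 a = (meaning-U a , λxy·y⦂U a)
           , (meaning-V a , λxy·x⦂V a)
           , (meaning-W a , λx·xP⦂W a)
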